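{- Let $\alpha>1$ and $\beta$ be constants, and let $(\mathbb{G},\mathbf{L})$ be a graph/list pair with $|L(u)|\ge\alpha\Delta(u)+\beta$ for every node $u$. Let $v$ be a node with neighbors $v_1,\dots,v_m$. Then for every $1\le k\le m$ and every $j\in L(v)$, the pair $(\mathbb{G}_v,\mathbf{L}_{k,j})$ satisfies $|L_{k,j}(u)|\ge\alpha\Delta_{\mathbb{G}_v}(u)+\beta$ for every node $u$ of $\mathbb{G}_v$.
   Context: $\Delta(u)$ is the degree of $u$ in $\mathbb{G}$ and $\Delta_{\mathbb{G}_v}(u)$ its degree in $\mathbb{G}_v$, the graph $\mathbb{G}$ with node $v$ deleted. $\mathbf{L}_{k,j}$ is the list vector on $\mathbb{G}_v$ given by $L_{k,j}(v_r)=L(v_r)\setminus\{j\}$ for $1\le r<k$ and $L_{k,j}(u)=L(u)$ for all other nodes $u$.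
   Formalization: The constants α and β are taken in the rationals. -}

module Defs where

open import Data.Nat using (ℕ; suc; _∸_)
open import Data.Fin using (Fin; punchIn)
open import Data.Fin.Subset using (Subset; _∈_; _-_; ∣_∣)
open import Data.Fin.Subset.Properties using (_∈?_)
open import Data.Vec using (tabulate; lookup)
open import Data.List using (List; take)
import Data.List.Membership.DecPropositional
open import Data.Fin.Properties using (_≟_)
open import Data.Integer using (+_)
open import Data.Rational using (ℚ; _/_; _*_; _+_; _≤_)
open import Relation.Nullary using (¬_; does)
open import Data.Bool using (if_then_else_)
open import Data.Product using (_×_)
open import Relation.Binary.PropositionalEquality using (_≡_)
open import Function.Bundles using (_⇔_)

record Graph (n : ℕ) : Set where
  field
    nbr : Fin n → Subset n
open Graph public

Simple : ∀ {n} → Graph n → Set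
Simple G = (∀ u w → w ∈ nbr G u → u ∈ nbr G w) × (∀ u → ¬ (u ∈ nbr G u))

deg : ∀ {n} → Graph n → Fin n → ℕ
deg G u = ∣ nbr G u ∣

-- 𝔾_v : delete node v; node u of 𝔾_v is node (punchIn v u) of 𝔾.
delete : ∀ {n} → Graph (suc n) → Fin (suc n) → Graph n
delete G v = record
  { nbr = λ u → tabulate (λ w → lookup (nbr G (punchIn v u)) (punchIn v w)) }

ListVec : ℕ → ℕ → Set
ListVec n c = Fin n → Subset c

size : ∀ {c} → Subset c → ℚ
size s = + ∣ s ∣ / 1

Satisfies : ∀ {n c} → ℚ → ℚ → Graph n → ListVec n c → Set
Satisfies α β G L = ∀ u → α * (+ deg G u / 1) + β ≤ size (L u)

-- 𝐋_{k,j} on 𝔾_v, where vs = (v₁,…,v_m) enumerates the neighbours of v: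
-- L_{k,j}(v_r) = L(v_r) ∖ {j} for 1 ≤ r < k, i.e. for v_r among the first k-1
-- entries of vs, and L_{k,j}(u) = L(u) otherwise.
Lkj : ∀ {n c} → ListVec (suc n) c → Fin (suc n) → List (Fin (suc n)) → ℕ → Fin c
    → ListVec n c
Lkj L v vs k j u =
  if does (punchIn v u DM.∈? take (k ∸ 1) vs)
  then L (punchIn v u) - j
  else L (punchIn v u)
  where module DM = Data.List.Membership.DecPropositional _≟_

{-# OPTIONS --safe #-}
module Submission where

open import Defs
open import Data.Nat using (ℕ; suc; _≤_)
open import Data.Fin using (Fin; punchIn)
open import Data.Fin.Subset using (_∈_)
open import Data.List using (List; length)
open import Data.List.Relation.Unary.Unique.Propositional using (Unique)
open import Data.List.Membership.Propositional as LM using ()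
open import Data.Rational using (ℚ; 1ℚ; _<_)
open import Function.Bundles using (_⇔_)

open import Data.Nat using (_∸_; s≤s)
import Data.Nat as ℕ
import Data.Nat.Properties as ℕ
open import Data.Fin using (zero; suc)
import Data.Fin.Properties as Fin
open import Data.Fin.Subset using (Subset; inside; outside; _─_; _-_; ⁅_⁆; ∣_∣)
open import Data.Fin.Subset.Properties using (∣p∣≤∣x∷p∣; ∣⁅x⁆∣≡1)
open import Data.Vec using ([]; _∷_; tabulate; lookup; here; there)
open import Data.Vec.Properties using (tabulate∘lookup)
open import Data.Integer using (+_)
import Data.Integer as ℤ
import Data.Integer.Properties as ℤ
open import Data.Rational using (_/_; _+_; _*_; NonNegative)
import Data.Rational as ℚ
import Data.Rational.Properties as ℚ
open import Data.Rational.Literals using (fromℤ)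
open import Data.Rational.Solver using (module +-*-Solver)
open import Data.List using (take)
open import Data.List.Relation.Binary.Sublist.Propositional.Properties using (take-⊆; Any-resp-⊆)
import Data.List.Membership.DecPropositional
open import Data.Product using (_×_; _,_)
open import Data.Sum using (_⊎_; inj₁; inj₂)
open import Function using (_∘_; Equivalence)
open import Relation.Binary.PropositionalEquality
open import Relation.Nullary using (yes; no; contradiction)

-- Deleting v lowers every degree by at most one, and by exactly one at the
-- neighbours of v. A list loses at most the colour j, and only at some v_r,
-- which is a neighbour of v. So a node either keeps its list while its degree
-- does not grow, or loses at most one colour while losing one degree, which
-- lowers the left-hand side α Δ + β by α > 1.

fromℕ : ℕ → ℚ
fromℕ n = + n / 1

fromℕ≡fromℤ : ∀ n → fromℕ n ≡ fromℤ (+ n)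
fromℕ≡fromℤ n = ℚ.↥p/↧p≡p (fromℤ (+ n))

fromℕ-mono-≤ : ∀ {m n} → m ≤ n → fromℕ m ℚ.≤ fromℕ n
fromℕ-mono-≤ {m} {n} m≤n rewrite fromℕ≡fromℤ m | fromℕ≡fromℤ n =
  ℚ.*≤* (ℤ.*-monoʳ-≤-nonNeg (+ 1) (ℤ.+≤+ m≤n))

fromℕ-suc : ∀ n → fromℕ (suc n) ≡ fromℕ n + 1ℚ
fromℕ-suc n = begin
  + suc n / 1                           ≡⟨ cong (λ m → + m / 1) (ℕ.+-comm 1 n) ⟩
  (+ n ℤ.+ + 1) / 1                     ≡⟨ cong (λ i → (i ℤ.+ + 1) / 1) (ℤ.*-identityʳ (+ n)) ⟨
  (+ n ℤ.* + 1 ℤ.+ + 1 ℤ.* + 1) / 1     ≡⟨⟩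
  fromℤ (+ n) + 1ℚ                      ≡⟨ cong (_+ 1ℚ) (fromℕ≡fromℤ n) ⟨
  fromℕ n + 1ℚ                          ∎
  where open ≡-Reasoning

p+r≤q+s∧s<r⇒p<q : ∀ {p q r s} → p + r ℚ.≤ q + s → s < r → p < q
p+r≤q+s∧s<r⇒p<q {p} {q} p+r≤q+s s<r with q ℚ.≤? p
... | yes q≤p = contradiction (ℚ.≤-<-trans p+r≤q+s (ℚ.+-mono-≤-< q≤p s<r)) (ℚ.<-irrefl refl)
... | no  q≰p = ℚ.≰⇒> q≰p

1<α⇒nonNegative : ∀ {α} → 1ℚ < α → NonNegative α
1<α⇒nonNegative 1<α = ℚ.nonNegative (ℚ.<⇒≤ (ℚ.<-trans (ℚ.positive⁻¹ 1ℚ) 1<α))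

lower-degree : ∀ α β {d′ d x} .{{_ : NonNegative α}} →
               d′ ≤ d → α * fromℕ d + β ℚ.≤ x → α * fromℕ d′ + β ℚ.≤ x
lower-degree α β d′≤d bound =
  ℚ.≤-trans (ℚ.+-monoˡ-≤ β (ℚ.*-monoˡ-≤-nonNeg α (fromℕ-mono-≤ d′≤d))) bound

lower-degree-and-size : ∀ α β {d′ d a′ a} → 1ℚ < α → suc d′ ≤ d → a ≤ suc a′ →
                        α * fromℕ d + β ℚ.≤ fromℕ a → α * fromℕ d′ + β ℚ.≤ fromℕ a′
lower-degree-and-size α β {d′} {d} {a′} {a} 1<α d′<d a≤1+a′ bound =
  ℚ.<⇒≤ (p+r≤q+s∧s<r⇒p<q (begin
    α * fromℕ d′ + β + α        ≡⟨ shift ⟩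
    α * fromℕ (suc d′) + β      ≤⟨ lower-degree α β {{1<α⇒nonNegative 1<α}} d′<d bound ⟩
    fromℕ a                     ≤⟨ fromℕ-mono-≤ a≤1+a′ ⟩
    fromℕ (suc a′)              ≡⟨ fromℕ-suc a′ ⟩
    fromℕ a′ + 1ℚ               ∎) 1<α)
  where
  open ℚ.≤-Reasoning
  open +-*-Solver
  shift : α * fromℕ d′ + β + α ≡ α * fromℕ (suc d′) + β
  shift rewrite fromℕ-suc d′ =
    solve 3 (λ a x b → a :* x :+ b :+ a := a :* (x :+ con 1ℚ) :+ b) refl α (fromℕ d′) β

restrict : ∀ {n} → Subset (suc n) → Fin (suc n) → Subset n
restrict p v = tabulate (lookup p ∘ punchIn v)

∣restrict∣≤∣p∣ : ∀ {n} (p : Subset (suc n)) v → ∣ restrict p v ∣ ≤ ∣ p ∣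
∣restrict∣≤∣p∣ (x ∷ p) zero rewrite tabulate∘lookup p = ∣p∣≤∣x∷p∣ x p
∣restrict∣≤∣p∣ {suc n} (inside  ∷ p) (suc v) = s≤s (∣restrict∣≤∣p∣ p v)
∣restrict∣≤∣p∣ {suc n} (outside ∷ p) (suc v) = ∣restrict∣≤∣p∣ p v

x∈p⇒∣restrict∣<∣p∣ : ∀ {n} {p : Subset (suc n)} {v} → v ∈ p → ∣ restrict p v ∣ ℕ.< ∣ p ∣
x∈p⇒∣restrict∣<∣p∣ {p = inside ∷ p} {zero} here rewrite tabulate∘lookup p = ℕ.≤-refl
x∈p⇒∣restrict∣<∣p∣ {suc n} {inside  ∷ p} {suc v} (there v∈p) = s≤s (x∈p⇒∣restrict∣<∣p∣ v∈p)
x∈p⇒∣restrict∣<∣p∣ {suc n} {outside ∷ p} {suc v} (there v∈p) = x∈p⇒∣restrict∣<∣p∣ v∈p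

∣p∣≤∣p─q∣+∣q∣ : ∀ {n} (p q : Subset n) → ∣ p ∣ ≤ ∣ p ─ q ∣ ℕ.+ ∣ q ∣
∣p∣≤∣p─q∣+∣q∣ []            []            = ℕ.≤-refl
∣p∣≤∣p─q∣+∣q∣ (inside  ∷ p) (inside  ∷ q) =
  ℕ.≤-trans (s≤s (∣p∣≤∣p─q∣+∣q∣ p q)) (ℕ.≤-reflexive (sym (ℕ.+-suc _ _)))
∣p∣≤∣p─q∣+∣q∣ (inside  ∷ p) (outside ∷ q) = s≤s (∣p∣≤∣p─q∣+∣q∣ p q)
∣p∣≤∣p─q∣+∣q∣ (outside ∷ p) (inside  ∷ q) =
  ℕ.≤-trans (∣p∣≤∣p─q∣+∣q∣ p q) (ℕ.+-monoʳ-≤ _ (ℕ.n≤1+n _))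
∣p∣≤∣p─q∣+∣q∣ (outside ∷ p) (outside ∷ q) = ∣p∣≤∣p─q∣+∣q∣ p q

∣p∣≤1+∣p-x∣ : ∀ {n} (p : Subset n) x → ∣ p ∣ ≤ suc ∣ p - x ∣
∣p∣≤1+∣p-x∣ p x = begin
  ∣ p ∣                      ≤⟨ ∣p∣≤∣p─q∣+∣q∣ p ⁅ x ⁆ ⟩
  ∣ p - x ∣ ℕ.+ ∣ ⁅ x ⁆ ∣    ≡⟨ cong (∣ p - x ∣ ℕ.+_) (∣⁅x⁆∣≡1 x) ⟩
  ∣ p - x ∣ ℕ.+ 1            ≡⟨ ℕ.+-comm ∣ p - x ∣ 1 ⟩
  suc ∣ p - x ∣              ∎
  where open ℕ.≤-Reasoning

deg-delete-≤ : ∀ {n} (G : Graph (suc n)) v u → deg (delete G v) u ≤ deg G (punchIn v u)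
deg-delete-≤ G v u = ∣restrict∣≤∣p∣ (nbr G (punchIn v u)) v

deg-delete-< : ∀ {n} (G : Graph (suc n)) v u →
               v ∈ nbr G (punchIn v u) → deg (delete G v) u ℕ.< deg G (punchIn v u)
deg-delete-< G v u = x∈p⇒∣restrict∣<∣p∣

module _ {n c : ℕ} (L : ListVec (suc n) c) (v : Fin (suc n)) (vs : List (Fin (suc n)))
         (k : ℕ) (j : Fin c) (u : Fin n) where

  open Data.List.Membership.DecPropositional (Fin._≟_ {suc n}) using (_∈?_)

  Lkj-cases : (punchIn v u LM.∈ vs × Lkj L v vs k j u ≡ L (punchIn v u) - j)
            ⊎ Lkj L v vs k j u ≡ L (punchIn v u)
  -- The `with` also abstracts the membership test inside Lkj, so both branches compute.
  Lkj-cases with punchIn v u ∈? take (k ∸ 1) vs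
  ... | yes u∈vs = inj₁ (Any-resp-⊆ (take-⊆ (k ∸ 1) vs) u∈vs , refl)
  ... | no  u∉vs = inj₂ refl

lemma1 : (α β : ℚ) → 1ℚ < α →
    {n c : ℕ} (G : Graph (suc n)) (L : ListVec (suc n) c) →
    Simple G → Satisfies α β G L →
    (v : Fin (suc n)) (vs : List (Fin (suc n))) →
    Unique vs → (∀ w → (w LM.∈ vs) ⇔ (w ∈ nbr G v)) →
    (k : ℕ) → 1 ≤ k → k ≤ length vs →
    (j : Fin c) → j ∈ L v →
    Satisfies α β (delete G v) (Lkj L v vs k j)
lemma1 α β 1<α G L (symmetric , _) sat v vs _ vs⇔nbr k _ _ j _ u
  with Lkj-cases L v vs k j u
... | inj₁ (u∈vs , Lu≡L-j) rewrite Lu≡L-j =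
  lower-degree-and-size α β 1<α
    (deg-delete-< G v u (symmetric v u′ (Equivalence.to (vs⇔nbr u′) u∈vs)))
    (∣p∣≤1+∣p-x∣ (L u′) j) (sat u′)
  where u′ = punchIn v u
... | inj₂ Lu≡L rewrite Lu≡L =
  lower-degree α β {{1<α⇒nonNegative 1<α}} (deg-delete-≤ G v u) (sat (punchIn v u))
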